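{- Let $m>1$ be an integer, let $a\in[1,m-1]$ be an integer and let $A$ be an $m$-extension with ${\rm Kunz}^p(A)=(k_1,\dots,k_{m-1})$. Suppose $k_\ell\in\{2,3\}$ for all $\ell\in[1,a-1]$, $k_a=3$, and $k_\ell\in\{1,2\}$ for all $\ell\in[a+1,m-1]$. Then $A$ is a gapset, and $A$ has depth $3$.
   Context: $\mathbb N$ is the set of positive integers, $\mathbb N_0=\mathbb N\cup\{0\}$, $[a,b]=\{x\in\mathbb Z: a\le x\le b\}$. For an integer $m>1$, an $m$-extension is a finite set $A\subset\mathbb N$ containing $[1,m-1]$ that admits a partition $A=A_0\cup\dots\cup A_t$ for some $t\in\mathbb N_0$, with $A_0=[1,m-1]$ and $A_{i+1}\subseteq m+A_i$ for all $i$. Its pseudo Kunz coordinates: for $i\in[1,m-1]$ let $w_i=m+\max\{a\in A: a\equiv i\pmod m\}$, write $w_i=mk_i+i$, and ${\rm Kunz}^p(A)=(k_1,\dots,k_{m-1})$. A gapset is a finite set $G\subset\mathbb N$ such that whenever $z\in G$ and $z=x+y$ with $x,y\in\mathbb N$, then $x\in G$ or $y\in G$. Its multiplicity is $m(G)=\min\{s\in\mathbb N_0\setminus G: s\ne0\}$, its conductor is $c(G)=\min\{s\in\mathbb N_0: s+n\notin G\ \forall n\in\mathbb N_0\}$, and its depth is $\lceil c(G)/m(G)\rceil$. -}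

module Defs where

open import Data.Nat using (ℕ; zero; suc; _+_; _*_; _∸_; _≤_; _<_)
open import Data.Product using (Σ; ∃; ∃-syntax; _×_)
open import Data.Sum using (_⊎_)
open import Data.List using (List)
open import Data.List.Relation.Unary.All using (All)
open import Data.List.Membership.Propositional using (_∈_; _∉_)
open import Relation.Binary.PropositionalEquality using (_≡_; _≢_)
open import Function.Bundles using (_⇔_)

PosSet : List ℕ → Set
PosSet A = All (1 ≤_) A

InInterval : ℕ → ℕ → ℕ → Set
InInterval a b x = a ≤ x × x ≤ b

-- A is an m-extension: A ⊂ ℕ finite, and there are t ∈ ℕ₀ and sets
-- A_0,…,A_t (given by `part`) partitioning A with A_0 = [1,m-1] and
-- A_{i+1} ⊆ m + A_i for all i < t.
-- ([1,m-1] ⊆ A follows from A_0 = [1,m-1] ⊆ A.)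
record IsMExtension (m : ℕ) (A : List ℕ) : Set where
  field
    positive  : PosSet A
    t         : ℕ
    part      : ℕ → List ℕ
    cover     : ∀ x → (x ∈ A) ⇔ (∃[ i ] (i ≤ t × x ∈ part i))
    disjoint  : ∀ i j x → i ≤ t → j ≤ t → x ∈ part i → x ∈ part j → i ≡ j
    part₀     : ∀ x → (x ∈ part 0) ⇔ InInterval 1 (m ∸ 1) x
    partStep  : ∀ i → i < t → ∀ x → x ∈ part (suc i) → ∃[ y ] (y ∈ part i × x ≡ m + y)

IsMax : (ℕ → Set) → ℕ → Set
IsMax P x = P x × (∀ y → P y → y ≤ x)

CongMod : ℕ → ℕ → ℕ → Set
CongMod m i a = ∃[ q ] (a ≡ i + q * m)

IsKunzP : ℕ → List ℕ → ℕ → ℕ → Set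
IsKunzP m A i k = ∃[ w ] (∃[ mx ] (IsMax (λ a → a ∈ A × CongMod m i a) mx
                                    × w ≡ m + mx × w ≡ m * k + i))

IsGapset : List ℕ → Set
IsGapset G = PosSet G ×
  (∀ z x y → z ∈ G → 1 ≤ x → 1 ≤ y → z ≡ x + y → x ∈ G ⊎ y ∈ G)

IsMin : (ℕ → Set) → ℕ → Set
IsMin P x = P x × (∀ y → P y → x ≤ y)

IsMultiplicity : List ℕ → ℕ → Set
IsMultiplicity G = IsMin (λ s → s ∉ G × s ≢ 0)

IsConductor : List ℕ → ℕ → Set
IsConductor G = IsMin (λ s → ∀ n → (s + n) ∉ G)

IsCeilDiv : ℕ → ℕ → ℕ → Set
IsCeilDiv c q = IsMin (λ d → c ≤ d * q)

HasDepth : List ℕ → ℕ → Set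
HasDepth G d = ∃[ mu ] (∃[ c ] (IsMultiplicity G mu × IsConductor G c × IsCeilDiv c mu d))

{-# OPTIONS --safe #-}
-- An m-extension A is determined by its pseudo Kunz coordinates: it consists
-- exactly of the numbers i + q m with 0 < i < m and q < k_i. Writing two
-- non-elements x = r + q m and y = s + p m in this form, their sum lies in A
-- only if k_{r+s} > q + p (no carry) or k_{r+s-m} > q + p + 1 (carry), which
-- the Kunz inequalities k_{r+s} ≤ k_r + k_s and k_{r+s-m} ≤ k_r + k_s + 1
-- rule out; so A is a gapset. Coordinates in {1,2,3} that are ≥ 2 below a
-- and ≤ 2 above a satisfy these inequalities. The largest element of A is
-- then a + 2m, so the conductor is a + 2m + 1 while the multiplicity is m,
-- giving depth 3.
module Submission where

open import Defs
open import Data.Nat using (ℕ; _≤_; _<_; _∸_; _+_)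
open import Data.Product using (_×_)
open import Data.Sum using (_⊎_)
open import Data.List using (List)
open import Relation.Binary.PropositionalEquality using (_≡_)

open import Data.Nat using (zero; suc; _*_; z≤n; s≤s; s≤s⁻¹; z<s; NonZero; >-nonZero; >-nonZero⁻¹; _≤?_; _<?_; _≟_)
open import Data.Nat.Properties
open import Data.Nat.DivMod using (_/_; _%_; m≡m%n+[m/n]*n; m%n<n)
open import Data.Nat.Solver using (module +-*-Solver)
open +-*-Solver using (solve; _:+_; _:*_; _:=_; con)
open import Data.Product using (_,_; proj₁; proj₂)
open import Data.Sum using (inj₁; inj₂; [_,_])
open import Data.List.Relation.Unary.All using (lookup)
open import Data.List.Membership.Propositional using (_∈_; _∉_)
open import Data.List.Membership.DecPropositional _≟_ using (_∈?_)
open import Relation.Binary.PropositionalEquality using (_≢_; refl; module ≡-Reasoning; sym; trans; cong; cong₂; subst)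
open import Relation.Nullary using (yes; no; contradiction)
open import Function.Base using (_∘_)
open import Function.Bundles using (_⇔_; mk⇔; Equivalence)
open Equivalence using (to; from)
open import Relation.Binary.Definitions using (tri<; tri≈; tri>)

≤∸1⇒< : ∀ {x n} → 0 < x → x ≤ n ∸ 1 → x < n
≤∸1⇒< {n = zero}  z<s ()
≤∸1⇒< {n = suc _} _   x≤n = s≤s x≤n

<⇒≤∸1 : ∀ {x n} → x < n → x ≤ n ∸ 1
<⇒≤∸1 (s≤s x≤n) = x≤n

x+[m+y]≡x+y+m : ∀ x y m → x + (m + y) ≡ x + y + m
x+[m+y]≡x+y+m x y m = trans (cong (x +_) (+-comm m y)) (sym (+-assoc x y m))

[r+q*m]+[s+p*m]≡r+s+[q+p]*m : ∀ r s q p m → r + q * m + (s + p * m) ≡ r + s + (q + p) * m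
[r+q*m]+[s+p*m]≡r+s+[q+p]*m = solve 5 (λ r s q p m → r :+ q :* m :+ (s :+ p :* m) := r :+ s :+ (q :+ p) :* m) refl

r+s≡m+t⇒t<m : ∀ {m r s t} → r < m → s < m → r + s ≡ m + t → t < m
r+s≡m+t⇒t<m {m} {t = t} r<m s<m eq = +-cancelˡ-< m t m (subst (_< m + m) eq (+-mono-< r<m s<m))

IsKunzSet : ℕ → (ℕ → ℕ) → List ℕ → Set
IsKunzSet m k A = ∀ i q → i < m → (i + q * m ∈ A ⇔ (0 < i × q < k i))

module MExtension {m : ℕ} {A : List ℕ} .{{_ : NonZero m}} (E : IsMExtension m A) where
  open IsMExtension E

  +m∈⇒∈ : ∀ {x} → x + m ∈ A → x ∈ A
  +m∈⇒∈ {x} x+m∈A with to (cover (x + m)) x+m∈A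
  ... | zero , _ , ∈A₀ = contradiction (m≤n+m m x) (<⇒≱ (≤∸1⇒< 0<x+m x+m≤m∸1))
    where
      0<x+m   = proj₁ (to (part₀ _) ∈A₀)
      x+m≤m∸1 = proj₂ (to (part₀ _) ∈A₀)
  ... | suc j , j<t , ∈Aⱼ₊₁ with partStep j j<t (x + m) ∈Aⱼ₊₁
  ...   | y , y∈Aⱼ , x+m≡m+y = from (cover x) (j , <⇒≤ j<t , subst (_∈ part j) (sym x≡y) y∈Aⱼ)
    where
      x≡y : x ≡ y
      x≡y = +-cancelˡ-≡ m x y (trans (+-comm m x) x+m≡m+y)

  +*m∈⇒∈ : ∀ {x} d → x + d * m ∈ A → x ∈ A
  +*m∈⇒∈ {x} zero    h = subst (_∈ A) (+-identityʳ x) h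
  +*m∈⇒∈ {x} (suc d) h = +*m∈⇒∈ d (+m∈⇒∈ (subst (_∈ A) (x+[m+y]≡x+y+m x (d * m) m) h))

  *m∉ : ∀ q → q * m ∉ A
  *m∉ q q*m∈A with lookup positive (+*m∈⇒∈ {0} q q*m∈A)
  ... | ()

  interval⊆ : ∀ {x} → 0 < x → x < m → x ∈ A
  interval⊆ 0<x x<m = from (cover _) (0 , z≤n , from (part₀ _) (0<x , <⇒≤∸1 x<m))

  isMultiplicity : IsMultiplicity A m
  isMultiplicity = (m∉A , λ m≡0 → <-irrefl (sym m≡0) (>-nonZero⁻¹ m)) , minimal
    where
      m∉A : m ∉ A
      m∉A = subst (_∉ A) (*-identityˡ m) (*m∉ 1)
      minimal : ∀ s → s ∉ A × s ≢ 0 → m ≤ s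
      minimal s (s∉A , s≢0) = ≮⇒≥ (s∉A ∘ interval⊆ (n≢0⇒n>0 s≢0))

  kunzP⇒∈⇔ : ∀ {i k} → IsKunzP m A i k → ∀ q → (i + q * m ∈ A ⇔ q < k)
  kunzP⇒∈⇔ {i} {k} (_ , mx , ((mx∈A , _) , maximal) , w≡m+mx , w≡m*k+i) q =
    mk⇔ (λ h → *-cancelʳ-≤ (suc q) k m (+-cancelˡ-≤ i _ _ (below-max h)))
        (λ q<k → +*m∈⇒∈ (k ∸ suc q) (subst (_∈ A) (mx≡ q<k) mx∈A))
    where
      open ≤-Reasoning
      mx+m≡i+k*m : mx + m ≡ i + k * m
      mx+m≡i+k*m = begin-equality
        mx + m    ≡⟨ +-comm mx m ⟩
        m + mx    ≡⟨ trans (sym w≡m+mx) w≡m*k+i ⟩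
        m * k + i ≡⟨ trans (+-comm (m * k) i) (cong (i +_) (*-comm m k)) ⟩
        i + k * m ∎
      below-max : i + q * m ∈ A → i + suc q * m ≤ i + k * m
      below-max h = begin
        i + suc q * m ≡⟨ x+[m+y]≡x+y+m i (q * m) m ⟩
        i + q * m + m ≤⟨ +-monoˡ-≤ m (maximal _ (h , q , refl)) ⟩
        mx + m        ≡⟨ mx+m≡i+k*m ⟩
        i + k * m     ∎
      mx≡ : q < k → mx ≡ i + q * m + (k ∸ suc q) * m
      mx≡ q<k = +-cancelʳ-≡ m mx _ (begin-equality
        mx + m                            ≡⟨ mx+m≡i+k*m ⟩
        i + k * m                         ≡⟨ cong (λ l → i + l * m) (sym (m+[n∸m]≡n q<k)) ⟩
        i + (suc q + d) * m               ≡⟨ solve 4 (λ i q d m → i :+ (con 1 :+ q :+ d) :* m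
                                               := i :+ q :* m :+ d :* m :+ m) refl i q d m ⟩
        i + q * m + d * m + m             ∎)
        where d = k ∸ suc q

  isKunzSet : ∀ {k} → (∀ ℓ → 1 ≤ ℓ → ℓ ≤ m ∸ 1 → IsKunzP m A ℓ (k ℓ)) → IsKunzSet m k A
  isKunzSet kunz zero      q _   = mk⇔ (λ q*m∈A → contradiction q*m∈A (*m∉ q)) λ { (() , _) }
  isKunzSet kunz i@(suc _) q i<m = mk⇔ (λ h → z<s , to i+q*m∈⇔ h) (from i+q*m∈⇔ ∘ proj₂)
    where
      i+q*m∈⇔ = kunzP⇒∈⇔ (kunz i z<s (<⇒≤∸1 i<m)) q

record KunzInequalities (m : ℕ) (k : ℕ → ℕ) : Set where
  field
    subadditive : ∀ {r s} → 0 < r → 0 < s → r + s < m → k (r + s) ≤ k r + k s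
    carry       : ∀ {r s t} → 0 < r → r < m → 0 < s → s < m → 0 < t → t < m →
                  r + s ≡ m + t → k t ≤ suc (k r + k s)

module _ {m : ℕ} {k : ℕ → ℕ} (ineq : KunzInequalities m k) where
  open KunzInequalities ineq

  no-carry-bound : ∀ {r s q p} → 0 < r + s → r + s < m →
                   (0 < r → k r ≤ q) → (0 < s → k s ≤ p) → k (r + s) ≤ q + p
  no-carry-bound {zero}  {s}     {q} {p} 0<s _ _ ks≤p = ≤-trans (ks≤p 0<s) (m≤n+m p q)
  no-carry-bound {suc r} {zero}  {q} {p} _   _ kr≤q _ =
    subst (λ ℓ → k ℓ ≤ q + p) (sym (+-identityʳ (suc r))) (≤-trans (kr≤q z<s) (m≤m+n q p))
  no-carry-bound {suc r} {suc s} _ r+s<m kr≤q ks≤p =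
    ≤-trans (subadditive z<s z<s r+s<m) (+-mono-≤ (kr≤q z<s) (ks≤p z<s))

  carry-bound : ∀ {r s t q p} → r < m → s < m → 0 < t → r + s ≡ m + t →
                (0 < r → k r ≤ q) → (0 < s → k s ≤ p) → k t ≤ suc (q + p)
  carry-bound {zero} {s} {t} _ s<m _ s≡m+t _ _ = contradiction (subst (m ≤_) (sym s≡m+t) (m≤m+n m t)) (<⇒≱ s<m)
  carry-bound {suc r} {zero} {t} r<m _ _ r+0≡m+t _ _ =
    contradiction (subst (m ≤_) (trans (sym r+0≡m+t) (+-identityʳ (suc r))) (m≤m+n m t)) (<⇒≱ r<m)
  carry-bound {suc r} {suc s} {t} r<m s<m 0<t eq kr≤q ks≤p =
    ≤-trans (carry z<s r<m z<s s<m 0<t (r+s≡m+t⇒t<m r<m s<m eq) eq) (s≤s (+-mono-≤ (kr≤q z<s) (ks≤p z<s)))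

module KunzSet {m : ℕ} {k : ℕ → ℕ} {A : List ℕ} (K : IsKunzSet m k A) where

  ∉⇒k≤ : ∀ {r q} → r < m → r + q * m ∉ A → 0 < r → k r ≤ q
  ∉⇒k≤ r<m ∉A 0<r = ≮⇒≥ (λ q<k → ∉A (from (K _ _ r<m) (0<r , q<k)))

  sum∉ : KunzInequalities m k → ∀ {r s q p} → r < m → s < m →
         (0 < r → k r ≤ q) → (0 < s → k s ≤ p) → (r + q * m) + (s + p * m) ∉ A
  sum∉ ineq {r} {s} {q} {p} r<m s<m kr≤q ks≤p z∈A with r + s <? m
  ... | yes r+s<m = <⇒≱ q+p<k (no-carry-bound ineq 0<r+s r+s<m kr≤q ks≤p)
    where
      membership = to (K (r + s) (q + p) r+s<m) (subst (_∈ A) ([r+q*m]+[s+p*m]≡r+s+[q+p]*m r s q p m) z∈A)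
      0<r+s = proj₁ membership
      q+p<k = proj₂ membership
  ... | no r+s≮m = <⇒≱ q+p<k (carry-bound ineq r<m s<m 0<t r+s≡m+t kr≤q ks≤p)
    where
      t = r + s ∸ m
      r+s≡m+t : r + s ≡ m + t
      r+s≡m+t = sym (m+[n∸m]≡n (≮⇒≥ r+s≮m))
      t<m = r+s≡m+t⇒t<m r<m s<m r+s≡m+t
      regroup : r + q * m + (s + p * m) ≡ t + suc (q + p) * m
      regroup = begin
        r + q * m + (s + p * m) ≡⟨ [r+q*m]+[s+p*m]≡r+s+[q+p]*m r s q p m ⟩
        r + s + (q + p) * m     ≡⟨ cong (_+ (q + p) * m) r+s≡m+t ⟩
        m + t + (q + p) * m     ≡⟨ solve 4 (λ m t q p → m :+ t :+ (q :+ p) :* m := t :+ (con 1 :+ (q :+ p)) :* m) refl m t q p ⟩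
        t + suc (q + p) * m     ∎
        where open ≡-Reasoning
      membership = to (K t (suc (q + p)) t<m) (subst (_∈ A) regroup z∈A)
      0<t   = proj₁ membership
      q+p<k = proj₂ membership

  gapClosed : .{{NonZero m}} → KunzInequalities m k →
              ∀ z x y → z ∈ A → 1 ≤ x → 1 ≤ y → z ≡ x + y → x ∈ A ⊎ y ∈ A
  gapClosed ineq _ x y z∈A _ _ refl with x ∈? A | y ∈? A
  ... | yes x∈A | _       = inj₁ x∈A
  ... | no _    | yes y∈A = inj₂ y∈A
  ... | no x∉A  | no y∉A  =
    contradiction (subst (_∈ A) (cong₂ _+_ (m≡m%n+[m/n]*n x m) (m≡m%n+[m/n]*n y m)) z∈A)
                  (sum∉ ineq (m%n<n x m) (m%n<n y m) (residue-bound x∉A) (residue-bound y∉A))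
    where
      residue-bound : ∀ {w} → w ∉ A → 0 < w % m → k (w % m) ≤ w / m
      residue-bound {w} w∉A = ∉⇒k≤ (m%n<n w m) (w∉A ∘ subst (_∈ A) (sym (m≡m%n+[m/n]*n w m)))

record Depth3Profile (m a : ℕ) (k : ℕ → ℕ) : Set where
  field
    0<a       : 0 < a
    a<m       : a < m
    k[a]≡3    : k a ≡ 3
    k-pos     : ∀ {ℓ} → 0 < ℓ → ℓ < m → 0 < k ℓ
    k≤3       : ∀ {ℓ} → 0 < ℓ → ℓ < m → k ℓ ≤ 3
    k≥2-below : ∀ {ℓ} → 0 < ℓ → ℓ < a → 2 ≤ k ℓ
    k≤2-above : ∀ {ℓ} → a < ℓ → ℓ < m → k ℓ ≤ 2

depth3⇒kunzInequalities : ∀ {m a k} → Depth3Profile m a k → KunzInequalities m k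
depth3⇒kunzInequalities {m} {a} {k} P = record { subadditive = subadditive ; carry = carry }
  where
    open Depth3Profile P
    subadditive : ∀ {r s} → 0 < r → 0 < s → r + s < m → k (r + s) ≤ k r + k s
    subadditive {r} {s} 0<r 0<s r+s<m with a <? r + s
    ... | yes a<r+s = ≤-trans (k≤2-above a<r+s r+s<m) (+-mono-≤ (k-pos 0<r r<m) (k-pos 0<s s<m))
      where
        r<m = ≤-<-trans (m≤m+n r s) r+s<m
        s<m = ≤-<-trans (m≤n+m s r) r+s<m
    ... | no a≮r+s = ≤-trans (k≤3 (<-≤-trans 0<r (m≤m+n r s)) r+s<m)
                             (≤-trans (n≤1+n 3) (+-mono-≤ (k≥2-below 0<r r<a) (k≥2-below 0<s s<a)))
      where
        r<a = <-≤-trans (m<m+n r 0<s) (≮⇒≥ a≮r+s)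
        s<a = <-≤-trans (m<n+m s 0<r) (≮⇒≥ a≮r+s)
    carry : ∀ {r s t} → 0 < r → r < m → 0 < s → s < m → 0 < t → t < m →
            r + s ≡ m + t → k t ≤ suc (k r + k s)
    carry 0<r r<m 0<s s<m 0<t t<m _ = ≤-trans (k≤3 0<t t<m) (s≤s (+-mono-≤ (k-pos 0<r r<m) (k-pos 0<s s<m)))

module Depth3 {m a : ℕ} {k : ℕ → ℕ} {A : List ℕ} (K : IsKunzSet m k A) (P : Depth3Profile m a k) where
  open Depth3Profile P

  top∈ : a + 2 * m ∈ A
  top∈ = from (K a 2 a<m) (0<a , ≤-reflexive (sym k[a]≡3))

  ∈⇒≤top : .{{NonZero m}} → ∀ x → x ∈ A → x ≤ a + 2 * m
  ∈⇒≤top x x∈A = subst (_≤ a + 2 * m) (sym (m≡m%n+[m/n]*n x m))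
                       (normal-form-≤top {q = x / m} (m%n<n x m) (subst (_∈ A) (m≡m%n+[m/n]*n x m) x∈A))
    where
      normal-form-≤top : ∀ {i q} → i < m → i + q * m ∈ A → i + q * m ≤ a + 2 * m
      normal-form-≤top {i} {q} i<m i+q*m∈A with i ≤? a
      ... | yes i≤a = +-mono-≤ i≤a (*-monoˡ-≤ m (s≤s⁻¹ (≤-trans q<k (k≤3 0<i i<m))))
        where
          0<i = proj₁ (to (K i q i<m) i+q*m∈A)
          q<k = proj₂ (to (K i q i<m) i+q*m∈A)
      ... | no i≰a = ≤-trans (+-mono-≤ (<⇒≤ i<m) (*-monoˡ-≤ m (s≤s⁻¹ (≤-trans q<k (k≤2-above (≰⇒> i≰a) i<m)))))
                             (m≤n+m (2 * m) a)
        where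
          q<k = proj₂ (to (K i q i<m) i+q*m∈A)

max⇒isConductor : ∀ {A top} → top ∈ A → (∀ x → x ∈ A → x ≤ top) → IsConductor A (suc top)
max⇒isConductor {A} {top} top∈A ≤top = above-top∉ , minimal
  where
    above-top∉ : ∀ n → suc top + n ∉ A
    above-top∉ n h = <⇒≱ (s≤s (m≤m+n top n)) (≤top _ h)
    minimal : ∀ s → (∀ n → s + n ∉ A) → suc top ≤ s
    minimal s avoids = ≰⇒> (λ s≤top → avoids (top ∸ s) (subst (_∈ A) (sym (m+[n∸m]≡n s≤top)) top∈A))

isCeilDiv-suc : ∀ {r d q} → 0 < r → r ≤ q → IsCeilDiv (r + d * q) q (suc d)
isCeilDiv-suc {r} {d} {q} 0<r r≤q = +-monoˡ-≤ (d * q) r≤q , minimal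
  where
    minimal : ∀ e → r + d * q ≤ e * q → suc d ≤ e
    minimal e h = ≰⇒> (λ e≤d → <⇒≱ (m<n+m (d * q) 0<r) (≤-trans h (*-monoˡ-≤ q e≤d)))

depth3Profile : ∀ {m a k} → 0 < a → a < m → (∀ {ℓ} → 0 < ℓ → ℓ < m → 0 < k ℓ) →
  (∀ ℓ → 1 ≤ ℓ → ℓ ≤ a ∸ 1 → k ℓ ≡ 2 ⊎ k ℓ ≡ 3) →
  k a ≡ 3 →
  (∀ ℓ → a + 1 ≤ ℓ → ℓ ≤ m ∸ 1 → k ℓ ≡ 1 ⊎ k ℓ ≡ 2) →
  Depth3Profile m a k
depth3Profile {m} {a} {k} 0<a a<m k-pos below k[a]≡3 above = record
  { 0<a = 0<a ; a<m = a<m ; k[a]≡3 = k[a]≡3 ; k-pos = k-pos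
  ; k≤3 = k≤3 ; k≥2-below = k≥2-below ; k≤2-above = k≤2-above }
  where
    k≥2-below : ∀ {ℓ} → 0 < ℓ → ℓ < a → 2 ≤ k ℓ
    k≥2-below {ℓ} 0<ℓ ℓ<a =
      [ ≤-reflexive ∘ sym , (λ e → ≤-trans (n≤1+n 2) (≤-reflexive (sym e))) ] (below ℓ 0<ℓ (<⇒≤∸1 ℓ<a))
    k≤2-above : ∀ {ℓ} → a < ℓ → ℓ < m → k ℓ ≤ 2
    k≤2-above {ℓ} a<ℓ ℓ<m =
      [ (λ e → ≤-trans (≤-reflexive e) (n≤1+n 1)) , ≤-reflexive ]
        (above ℓ (subst (_≤ ℓ) (+-comm 1 a) a<ℓ) (<⇒≤∸1 ℓ<m))
    k≤3 : ∀ {ℓ} → 0 < ℓ → ℓ < m → k ℓ ≤ 3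
    k≤3 {ℓ} 0<ℓ ℓ<m with <-cmp ℓ a
    ... | tri< ℓ<a _ _ = [ (λ e → ≤-trans (≤-reflexive e) (n≤1+n 2)) , ≤-reflexive ] (below ℓ 0<ℓ (<⇒≤∸1 ℓ<a))
    ... | tri≈ _ ℓ≡a _ = ≤-reflexive (trans (cong k ℓ≡a) k[a]≡3)
    ... | tri> _ _ a<ℓ = ≤-trans (k≤2-above a<ℓ ℓ<m) (n≤1+n 2)

theorem5p1 : (m a : ℕ) → 1 < m → 1 ≤ a → a ≤ m ∸ 1 →
    (A : List ℕ) → IsMExtension m A →
    (k : ℕ → ℕ) → (∀ ℓ → 1 ≤ ℓ → ℓ ≤ m ∸ 1 → IsKunzP m A ℓ (k ℓ)) →
    (∀ ℓ → 1 ≤ ℓ → ℓ ≤ a ∸ 1 → k ℓ ≡ 2 ⊎ k ℓ ≡ 3) →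
    k a ≡ 3 →
    (∀ ℓ → a + 1 ≤ ℓ → ℓ ≤ m ∸ 1 → k ℓ ≡ 1 ⊎ k ℓ ≡ 2) →
    IsGapset A × HasDepth A 3
theorem5p1 m a 1<m 0<a a≤m∸1 A E k kunz below k[a]≡3 above =
  (IsMExtension.positive E , gapClosed (depth3⇒kunzInequalities P)) ,
  (m , suc a + 2 * m , isMultiplicity , max⇒isConductor top∈ ∈⇒≤top , isCeilDiv-suc z<s a<m)
  where
    instance
      m≢0 : NonZero m
      m≢0 = >-nonZero (<-trans z<s 1<m)
    open MExtension E
    K : IsKunzSet m k A
    K = isKunzSet kunz
    open KunzSet K
    a<m = ≤∸1⇒< 0<a a≤m∸1
    k-pos : ∀ {ℓ} → 0 < ℓ → ℓ < m → 0 < k ℓ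
    k-pos {ℓ} 0<ℓ ℓ<m = proj₂ (to (K ℓ 0 ℓ<m) (subst (_∈ A) (sym (+-identityʳ ℓ)) (interval⊆ 0<ℓ ℓ<m)))
    P : Depth3Profile m a k
    P = depth3Profile 0<a a<m k-pos below k[a]≡3 above
    open Depth3 K P
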